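{- Let $\mathcal{P}$ and $\mathcal{Q}$ be finite chiral or directly regular $n$-polytopes such that $\Gamma^+(\mathcal{P})\Box\Gamma^+(\mathcal{Q})$ is trivial. Then $\Gamma^+(\mathcal{P})\diamond\Gamma^+(\mathcal{Q}) = \Gamma^+(\mathcal{P})\times\Gamma^+(\mathcal{Q})$.
   Context: All polytopes are abstract polytopes. A regular $n$-polytope has automorphism group generated by involutions $\rho_0,\dots,\rho_{n-1}$ (relative to a base flag); it is directly regular if the subgroup generated by $\sigma_i=\rho_{i-1}\rho_i$ ($i=1,\dots,n-1$), the rotation group $\Gamma^+(\mathcal{P})$, has index $2$. A polytope is chiral if its automorphism group has two orbits on flags, with adjacent flags in distinct orbits; then $\Gamma^+(\mathcal{P})$ denotes the full automorphism group, generated by the standard rotations $\sigma_1,\dots,\sigma_{n-1}$ relative to a base flag. Mix: if $\Gamma^+(\mathcal{P})=\langle\sigma_1,\dots,\sigma_{n-1}\rangle$ and $\Gamma^+(\mathcal{Q})=\langle\sigma_1',\dots,\sigma_{n-1}'\rangle$ (distinguished generators), then $\Gamma^+(\mathcal{P})\diamond\Gamma^+(\mathcal{Q})$ is the subgroup of $\Gamma^+(\mathcal{P})\times\Gamma^+(\mathcal{Q})$ generated by $(\sigma_i,\sigma_i')$, $i=1,\dots,n-1$. Comix: if $\Gamma^+(\mathcal{P})$ has presentation $\langle \sigma_1,\dots,\sigma_{n-1}\mid R\rangle$ and $\Gamma^+(\mathcal{Q})$ has presentation $\langle \sigma_1',\dots,\sigma_{n-1}'\mid S\rangle$, then $\Gamma^+(\mathcal{P})\Box\Gamma^+(\mathcal{Q})$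 is the group with presentation $\langle \sigma_1,\sigma_1',\dots,\sigma_{n-1},\sigma_{n-1}'\mid R,S,\sigma_1^{ -1}\sigma_1',\dots,\sigma_{n-1}^{ -1}\sigma_{n-1}'\rangle$. -}

module Defs where

open import Data.Nat as ℕ using (ℕ; zero; suc; _+_; _∸_)
open import Data.Fin using (Fin; toℕ)
open import Data.Bool using (Bool; true; false; not)
open import Data.List using (List; []; _∷_; _++_; map)
open import Data.Product using (Σ; ∃; ∃-syntax; _×_; _,_)
open import Data.Sum using (_⊎_; inj₁; inj₂)
open import Relation.Nullary using (¬_)
open import Relation.Binary.PropositionalEquality using (_≡_; _≢_)
open import Function using (_∘_; id)
open import Function.Bundles using (_↔_)

-- Faces carry a *shifted* rank: rank F = (actual rank of F) + 1, so the
-- least face F₋₁ has shifted rank 0 and the greatest face Fₙ has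
-- shifted rank n+1.  A flag is listed by position i : Fin (n+2), the
-- face at position i having actual rank i-1.

record RankedPoset (n : ℕ) : Set₁ where
  field
    Face      : Set
    _≤_       : Face → Face → Set
    ≤-refl    : ∀ F → F ≤ F
    ≤-trans   : ∀ {F G H} → F ≤ G → G ≤ H → F ≤ H
    ≤-antisym : ∀ {F G} → F ≤ G → G ≤ F → F ≡ G
    least     : Face
    greatest  : Face
    least-≤   : ∀ F → least ≤ F
    ≤-greatest : ∀ F → F ≤ greatest
    rank      : Face → ℕ
    rank-least    : rank least ≡ 0
    rank-greatest : rank greatest ≡ suc n
    rank-cover : ∀ F G → F ≤ G → F ≢ G →
                 (∀ H → F ≤ H → H ≤ G → H ≡ F ⊎ H ≡ G) →
                 rank G ≡ suc (rank F)

  _<_ : Face → Face → Set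
  F < G = F ≤ G × F ≢ G

  record Flag : Set where
    field
      face      : Fin (suc (suc n)) → Face
      face-rank : ∀ i → rank (face i) ≡ toℕ i
      face-mono : ∀ i j → toℕ i ℕ.≤ toℕ j → face i ≤ face j
  open Flag public

  _≈F_ : Flag → Flag → Set
  Φ ≈F Ψ = ∀ i → face Φ i ≡ face Ψ i

  -- Φ and Ψ are r-adjacent (r = actual rank): they differ exactly in
  -- their face of rank r (position r+1).
  Adj : ℕ → Flag → Flag → Set
  Adj r Φ Ψ = (∀ i → toℕ i ≢ suc r → face Φ i ≡ face Ψ i) × ¬ (Φ ≈F Ψ)

  ContainsMeet : Flag → Flag → Flag → Set
  ContainsMeet Φ₀ Ψ₀ Χ = ∀ i → face Φ₀ i ≡ face Ψ₀ i → face Χ i ≡ face Φ₀ i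

  data Reach (Φ₀ Ψ₀ : Flag) : Flag → Set where
    start : Reach Φ₀ Ψ₀ Φ₀
    step  : ∀ {Χ Χ'} r → Reach Φ₀ Ψ₀ Χ → Adj r Χ Χ' →
            ContainsMeet Φ₀ Ψ₀ Χ' → Reach Φ₀ Ψ₀ Χ'

  Between : Face → Face → Face → Set
  Between F G H = F < H × H < G

record IsPolytope {n : ℕ} (P : RankedPoset n) : Set where
  open RankedPoset P
  field
    diamond : ∀ F G → F ≤ G → rank G ≡ 2 + rank F →
              ∃[ H₁ ] ∃[ H₂ ] (H₁ ≢ H₂ × Between F G H₁ × Between F G H₂ ×
                               (∀ H → Between F G H → H ≡ H₁ ⊎ H ≡ H₂))
    strongly-flag-connected :
      ∀ Φ Ψ → ∃[ Χ ] (Reach Φ Ψ Χ × Χ ≈F Ψ)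

record Polytope (n : ℕ) : Set₁ where
  field
    poset      : RankedPoset n
    isPolytope : IsPolytope poset
  open RankedPoset poset public

Finite : ∀ {n} → Polytope n → Set
Finite P = ∃[ m ] (Polytope.Face P ↔ Fin m)

module _ {n : ℕ} (P : Polytope n) where
  open Polytope P

  record Aut : Set where
    field
      fun  : Face → Face
      inv  : Face → Face
      inv-fun : ∀ F → inv (fun F) ≡ F
      fun-inv : ∀ F → fun (inv F) ≡ F
      fun-mono : ∀ {F G} → F ≤ G → fun F ≤ fun G
      inv-mono : ∀ {F G} → F ≤ G → inv F ≤ inv G
  open Aut public

  MapsTo : Aut → Flag → Flag → Set
  MapsTo f Φ Ψ = ∀ i → fun f (face Φ i) ≡ face Ψ i

_≗_ : {A : Set} → (A → A) → (A → A) → Set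
f ≗ g = ∀ x → f x ≡ g x

-- Words in generators (letter = generator + "inverted?" flag) and their
-- evaluation.

Word : Set → Set
Word G = List (G × Bool)

evalWord : {G A : Set} → (G → A → A) → (G → A → A) → Word G → A → A
evalWord s s⁻¹ []               = id
evalWord s s⁻¹ ((g , false) ∷ w) = s g ∘ evalWord s s⁻¹ w
evalWord s s⁻¹ ((g , true) ∷ w)  = s⁻¹ g ∘ evalWord s s⁻¹ w

-- Base flag with standard rotations σ₁,…,σₙ₋₁ (index k : Fin (n-1)
-- stands for σ_{k+1}).  σᵢ maps the base flag Φ to Φ^{i,i-1}, i.e. to
-- the (i-1)-adjacent flag of the i-adjacent flag of Φ.

record Rotations {n : ℕ} (P : Polytope n) : Set where
  open Polytope P
  field
    base : Flag
    σ    : Fin (n ∸ 1) → Aut P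
    σ-spec : ∀ k → ∃[ Χ ] (Adj (suc (toℕ k)) base Χ ×
                           Σ Flag λ Ψ → Adj (toℕ k) Χ Ψ × MapsTo P (σ k) base Ψ)

  ev : Word (Fin (n ∸ 1)) → Face → Face
  ev = evalWord (λ k → fun (σ k)) (λ k → inv (σ k))

  InΓ⁺ : (Face → Face) → Set
  InΓ⁺ f = ∃[ w ] (f ≗ ev w)

module _ {n : ℕ} {P : Polytope n} (R : Rotations P) where
  open Polytope P
  open Rotations R

  Regular : Set
  Regular = ∀ Ψ → ∃[ f ] MapsTo P f base Ψ

  -- directly regular: regular and ⟨σ₁,…,σₙ₋₁⟩ has index 2 in Γ(P)
  DirectlyRegular : Set
  DirectlyRegular =
    Regular ×
    Σ (Aut P) λ g → ¬ InΓ⁺ (fun g) ×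
      (∀ (f : Aut P) → InΓ⁺ (fun f) ⊎ ∃[ w ] (fun f ≗ (fun g ∘ ev w)))

  Chiral : Set
  Chiral =
    (∀ Ψ → (∃[ f ] MapsTo P f base Ψ) ⊎
           (∃[ Χ ] (Adj 0 base Χ × ∃[ f ] MapsTo P f Χ Ψ))) ×
    (∀ r Ψ Χ → Adj r Ψ Χ → ∀ f → ¬ MapsTo P f Ψ Χ)

  ChiralOrDirectlyRegular : Set
  ChiralOrDirectlyRegular = Chiral ⊎ DirectlyRegular

-- Comix Γ⁺(P) □ Γ⁺(Q): generators σᵢ (inj₁ i) and σᵢ' (inj₂ i); relators
-- R (all relators of Γ⁺(P) in the σᵢ), S (all relators of Γ⁺(Q) in the
-- σᵢ'), and σᵢ⁻¹σᵢ'.  The group is words modulo the congruence below.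

module _ {n : ℕ} {P Q : Polytope n} (RP : Rotations P) (RQ : Rotations Q) where
  private
    Gen = Fin (n ∸ 1)
    CWord = Word (Gen ⊎ Gen)
    flipL : (Gen ⊎ Gen) × Bool → (Gen ⊎ Gen) × Bool
    flipL (x , b) = (x , not b)

  RelP : Word Gen → Set
  RelP r = Rotations.ev RP r ≗ id

  RelQ : Word Gen → Set
  RelQ r = Rotations.ev RQ r ≗ id

  data _∼_ : CWord → CWord → Set where
    ∼-refl  : ∀ {u} → u ∼ u
    ∼-sym   : ∀ {u v} → u ∼ v → v ∼ u
    ∼-trans : ∀ {u v w} → u ∼ v → v ∼ w → u ∼ w
    cancel  : ∀ u x v → (u ++ x ∷ flipL x ∷ v) ∼ (u ++ v)
    relP    : ∀ u r v → RelP r →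
              (u ++ map (λ { (g , b) → (inj₁ g , b) }) r ++ v) ∼ (u ++ v)
    relQ    : ∀ u r v → RelQ r →
              (u ++ map (λ { (g , b) → (inj₂ g , b) }) r ++ v) ∼ (u ++ v)
    ident   : ∀ u i v → (u ++ (inj₁ i , true) ∷ (inj₂ i , false) ∷ v) ∼ (u ++ v)

  ComixTrivial : Set
  ComixTrivial = ∀ w → w ∼ []

  -- Γ⁺(P) ◇ Γ⁺(Q) = Γ⁺(P) × Γ⁺(Q): every pair (g,h) is the image of a
  -- common word in the generators (σᵢ,σᵢ')
  MixIsProduct : Set
  MixIsProduct =
    ∀ u v → ∃[ w ] (Rotations.ev RP w ≗ Rotations.ev RP u ×
                    Rotations.ev RQ w ≗ Rotations.ev RQ v)

module Submission where

-- Let K_P ⊆ Γ⁺(P) be the set of values in P of those words in the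
-- σᵢ that are trivial in Q, i.e. K_P × 1 = (Γ⁺(P) ◇ Γ⁺(Q)) ∩ (Γ⁺(P) × 1).
-- Forgetting which side a letter comes from maps comix words to words in
-- the σᵢ, and each defining relation of the comix (free cancellation, the
-- identification σᵢ = σᵢ', relators of P, relators of Q) preserves the
-- coset of the P-value modulo K_P; for a relator of Q this is because its
-- conjugates are still trivial in Q.  Hence, if the comix is trivial,
-- every P-value lies in K_P, i.e. is attained by a word trivial in Q, and
-- symmetrically for Q.  Concatenating the two witnesses realises any pair
-- (g, h) ∈ Γ⁺(P) × Γ⁺(Q) in the mix.

open import Data.Nat using (ℕ; _∸_)
open import Data.Fin using (Fin)
open import Data.Bool using (Bool; true; false; not)
open import Data.List using ([]; _∷_; _++_; map)
open import Data.List.Properties using (map-++; map-∘; map-id)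
open import Data.Product using (∃-syntax; _×_; _,_)
open import Data.Sum using (_⊎_; inj₁; inj₂; reduce)
open import Relation.Binary.PropositionalEquality
  using (_≡_; refl; sym; trans; cong; subst₂; module ≡-Reasoning)
open import Function using (_∘_; id)
open import Defs

inverseLetter : {G : Set} → G × Bool → G × Bool
inverseLetter (g , b) = (g , not b)

inverseWord : {G : Set} → Word G → Word G
inverseWord []      = []
inverseWord (l ∷ w) = inverseWord w ++ inverseLetter l ∷ []

record Action (G : Set) : Set₁ where
  field
    Point     : Set
    act       : G → Point → Point
    act⁻¹     : G → Point → Point
    act-act⁻¹ : ∀ g x → act g (act⁻¹ g x) ≡ x
    act⁻¹-act : ∀ g x → act⁻¹ g (act g x) ≡ x

  ev : Word G → Point → Point
  ev = evalWord act act⁻¹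

  Trivial : Word G → Set
  Trivial w = ev w ≗ id

  ev-++ : ∀ u v x → ev (u ++ v) x ≡ ev u (ev v x)
  ev-++ []               v x = refl
  ev-++ ((g , false) ∷ u) v x = cong (act g) (ev-++ u v x)
  ev-++ ((g , true) ∷ u)  v x = cong (act⁻¹ g) (ev-++ u v x)

  cancelʳ : ∀ l x → ev (l ∷ []) (ev (inverseLetter l ∷ []) x) ≡ x
  cancelʳ (g , false) = act-act⁻¹ g
  cancelʳ (g , true)  = act⁻¹-act g

  cancelˡ : ∀ l x → ev (inverseLetter l ∷ []) (ev (l ∷ []) x) ≡ x
  cancelˡ (g , false) = act⁻¹-act g
  cancelˡ (g , true)  = act-act⁻¹ g

  cancel-trivial : ∀ l → Trivial (l ∷ inverseLetter l ∷ [])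
  cancel-trivial l x = trans (ev-++ (l ∷ []) (inverseLetter l ∷ []) x) (cancelʳ l x)

  ev-inverseʳ : ∀ w x → ev w (ev (inverseWord w) x) ≡ x
  ev-inverseʳ []      x = refl
  ev-inverseʳ (l ∷ w) x = begin
    ev (l ∷ w) (ev (inverseWord w ++ l⁻¹ ∷ []) x)
      ≡⟨ ev-++ (l ∷ []) w _ ⟩
    ev (l ∷ []) (ev w (ev (inverseWord w ++ l⁻¹ ∷ []) x))
      ≡⟨ cong (ev (l ∷ []) ∘ ev w) (ev-++ (inverseWord w) (l⁻¹ ∷ []) x) ⟩
    ev (l ∷ []) (ev w (ev (inverseWord w) (ev (l⁻¹ ∷ []) x)))
      ≡⟨ cong (ev (l ∷ [])) (ev-inverseʳ w _) ⟩
    ev (l ∷ []) (ev (l⁻¹ ∷ []) x)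
      ≡⟨ cancelʳ l x ⟩
    x ∎
    where open ≡-Reasoning
          l⁻¹ = inverseLetter l

  ev-inverseˡ : ∀ w x → ev (inverseWord w) (ev w x) ≡ x
  ev-inverseˡ []      x = refl
  ev-inverseˡ (l ∷ w) x = begin
    ev (inverseWord w ++ l⁻¹ ∷ []) (ev (l ∷ w) x)
      ≡⟨ ev-++ (inverseWord w) (l⁻¹ ∷ []) _ ⟩
    ev (inverseWord w) (ev (l⁻¹ ∷ []) (ev (l ∷ w) x))
      ≡⟨ cong (ev (inverseWord w) ∘ ev (l⁻¹ ∷ [])) (ev-++ (l ∷ []) w x) ⟩
    ev (inverseWord w) (ev (l⁻¹ ∷ []) (ev (l ∷ []) (ev w x)))
      ≡⟨ cong (ev (inverseWord w)) (cancelˡ l _) ⟩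
    ev (inverseWord w) (ev w x)
      ≡⟨ ev-inverseˡ w x ⟩
    x ∎
    where open ≡-Reasoning
          l⁻¹ = inverseLetter l

  trivial-inverse : ∀ w → Trivial w → Trivial (inverseWord w)
  trivial-inverse w w-triv x = trans (sym (w-triv _)) (ev-inverseʳ w x)

  trivial-++ : ∀ u v → Trivial u → Trivial v → Trivial (u ++ v)
  trivial-++ u v u-triv v-triv x =
    trans (ev-++ u v x) (trans (u-triv _) (v-triv x))

  trivial-conjugate : ∀ v {r} → Trivial r → Trivial (inverseWord v ++ r ++ v)
  trivial-conjugate v {r} r-triv x = begin
    ev (inverseWord v ++ r ++ v) x     ≡⟨ ev-++ (inverseWord v) (r ++ v) x ⟩
    ev (inverseWord v) (ev (r ++ v) x) ≡⟨ cong (ev (inverseWord v)) (ev-++ r v x) ⟩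
    ev (inverseWord v) (ev r (ev v x)) ≡⟨ cong (ev (inverseWord v)) (r-triv _) ⟩
    ev (inverseWord v) (ev v x)        ≡⟨ ev-inverseˡ v x ⟩
    x ∎
    where open ≡-Reasoning

  delete-trivial : ∀ {m} → Trivial m → ∀ u v x → ev (u ++ m ++ v) x ≡ ev (u ++ v) x
  delete-trivial {m} m-triv u v x = begin
    ev (u ++ m ++ v) x     ≡⟨ ev-++ u (m ++ v) x ⟩
    ev u (ev (m ++ v) x)   ≡⟨ cong (ev u) (ev-++ m v x) ⟩
    ev u (ev m (ev v x))   ≡⟨ cong (ev u) (m-triv _) ⟩
    ev u (ev v x)          ≡⟨ sym (ev-++ u v x) ⟩
    ev (u ++ v) x ∎
    where open ≡-Reasoning

  ev-conjugate : ∀ u r v x →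
    ev (u ++ r ++ v) x ≡ ev (u ++ v) (ev (inverseWord v ++ r ++ v) x)
  ev-conjugate u r v x = begin
    ev (u ++ r ++ v) x
      ≡⟨ ev-++ u (r ++ v) x ⟩
    ev u (ev (r ++ v) x)
      ≡⟨ cong (ev u) (sym (ev-inverseʳ v _)) ⟩
    ev u (ev v (ev (inverseWord v) (ev (r ++ v) x)))
      ≡⟨ cong (ev u ∘ ev v) (sym (ev-++ (inverseWord v) (r ++ v) x)) ⟩
    ev u (ev v (ev (inverseWord v ++ r ++ v) x))
      ≡⟨ sym (ev-++ u v _) ⟩
    ev (u ++ v) (ev (inverseWord v ++ r ++ v) x) ∎
    where open ≡-Reasoning

rotationAction : ∀ {n} {P : Polytope n} → Rotations P → Action (Fin (n ∸ 1))
rotationAction {P = P} R = record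
  { Point     = Polytope.Face P
  ; act       = λ k → fun (σ k)
  ; act⁻¹     = λ k → inv (σ k)
  ; act-act⁻¹ = λ k → fun-inv (σ k)
  ; act⁻¹-act = λ k → inv-fun (σ k)
  }
  where open Rotations R

data WordEq {G : Set} (R₁ R₂ : Word G → Set) : Word G → Word G → Set where
  weq-refl   : ∀ {u} → WordEq R₁ R₂ u u
  weq-sym    : ∀ {u v} → WordEq R₁ R₂ u v → WordEq R₁ R₂ v u
  weq-trans  : ∀ {u v w} → WordEq R₁ R₂ u v → WordEq R₁ R₂ v w → WordEq R₁ R₂ u w
  weq-cancel : ∀ u l v → WordEq R₁ R₂ (u ++ l ∷ inverseLetter l ∷ v) (u ++ v)
  weq-rel₁   : ∀ u r v → R₁ r → WordEq R₁ R₂ (u ++ r ++ v) (u ++ v)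
  weq-rel₂   : ∀ u r v → R₂ r → WordEq R₁ R₂ (u ++ r ++ v) (u ++ v)

WordEq-swap : ∀ {G} {R₁ R₂ : Word G → Set} {u v} →
              WordEq R₁ R₂ u v → WordEq R₂ R₁ u v
WordEq-swap weq-refl              = weq-refl
WordEq-swap (weq-sym e)           = weq-sym (WordEq-swap e)
WordEq-swap (weq-trans e f)       = weq-trans (WordEq-swap e) (WordEq-swap f)
WordEq-swap (weq-cancel u l v)    = weq-cancel u l v
WordEq-swap (weq-rel₁ u r v triv) = weq-rel₂ u r v triv
WordEq-swap (weq-rel₂ u r v triv) = weq-rel₁ u r v triv

module Coset {G : Set} (A B : Action G) where
  private
    module A = Action A
    module B = Action B

  CongruentModKernel : Word G → Word G → Set
  CongruentModKernel u v =
    ∃[ w ] (B.Trivial w × ∀ x → A.ev u x ≡ A.ev v (A.ev w x))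

  congruent : ∀ {u v} → WordEq A.Trivial B.Trivial u v → CongruentModKernel u v
  congruent weq-refl = [] , (λ _ → refl) , (λ _ → refl)
  congruent (weq-sym {u} {v} e) with congruent e
  ... | w , w-triv , eq = inverseWord w , B.trivial-inverse w w-triv , λ x →
    trans (cong (A.ev v) (sym (A.ev-inverseʳ w x))) (sym (eq _))
  congruent (weq-trans {w = t} e f) with congruent e | congruent f
  ... | w₁ , t₁ , eq₁ | w₂ , t₂ , eq₂ = w₂ ++ w₁ , B.trivial-++ w₂ w₁ t₂ t₁ , λ x →
    trans (eq₁ x) (trans (eq₂ _) (cong (A.ev t) (sym (A.ev-++ w₂ w₁ x))))
  congruent (weq-cancel u l v) =
    [] , (λ _ → refl) , A.delete-trivial (A.cancel-trivial l) u v
  congruent (weq-rel₁ u r v r-triv) =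
    [] , (λ _ → refl) , A.delete-trivial r-triv u v
  congruent (weq-rel₂ u r v r-triv) =
    inverseWord v ++ r ++ v , B.trivial-conjugate v r-triv , A.ev-conjugate u r v

forgetLetter : {G : Set} → (G ⊎ G) × Bool → G × Bool
forgetLetter (x , b) = (reduce x , b)

forget : {G : Set} → Word (G ⊎ G) → Word G
forget = map forgetLetter

forget-splice : ∀ {G : Set} (u m v : Word (G ⊎ G)) →
                forget (u ++ m ++ v) ≡ forget u ++ forget m ++ forget v
forget-splice u m v =
  trans (map-++ forgetLetter u (m ++ v)) (cong (forget u ++_) (map-++ forgetLetter m v))

module _ {n : ℕ} {P Q : Polytope n} (RP : Rotations P) (RQ : Rotations Q) where
  private
    G = Fin (n ∸ 1)
    actP = rotationAction RP
    actQ = rotationAction RQ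
    module AP = Action actP
    module AQ = Action actQ

  embed₁ embed₂ : Word G → Word (G ⊎ G)
  embed₁ = map (λ { (g , b) → (inj₁ g , b) })
  embed₂ = map (λ { (g , b) → (inj₂ g , b) })

  forget-embed₁ : ∀ r → forget (embed₁ r) ≡ r
  forget-embed₁ r = trans (sym (map-∘ r)) (map-id r)

  forget-embed₂ : ∀ r → forget (embed₂ r) ≡ r
  forget-embed₂ r = trans (sym (map-∘ r)) (map-id r)

  -- each defining relation of the comix becomes a cancellation or a
  -- relator of P or of Q once sides are forgotten
  forget-respects : ∀ {c d} → _∼_ RP RQ c d → WordEq AP.Trivial AQ.Trivial (forget c) (forget d)
  forget-respects ∼-refl          = weq-refl
  forget-respects (∼-sym e)       = weq-sym (forget-respects e)
  forget-respects (∼-trans e f)   = weq-trans (forget-respects e) (forget-respects f)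
  forget-respects (cancel u x v)  =
    subst₂ (WordEq _ _) (sym (map-++ forgetLetter u _)) (sym (map-++ forgetLetter u v))
      (weq-cancel (forget u) (forgetLetter x) (forget v))
  forget-respects (relP u r v r-triv) =
    subst₂ (WordEq _ _)
      (sym (trans (forget-splice u (embed₁ r) v) (cong (λ m → forget u ++ m ++ forget v) (forget-embed₁ r))))
      (sym (map-++ forgetLetter u v))
      (weq-rel₁ (forget u) r (forget v) r-triv)
  forget-respects (relQ u r v r-triv) =
    subst₂ (WordEq _ _)
      (sym (trans (forget-splice u (embed₂ r) v) (cong (λ m → forget u ++ m ++ forget v) (forget-embed₂ r))))
      (sym (map-++ forgetLetter u v))
      (weq-rel₂ (forget u) r (forget v) r-triv)
  forget-respects (ident u i v)   =
    subst₂ (WordEq _ _) (sym (map-++ forgetLetter u _)) (sym (map-++ forgetLetter u v))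
      (weq-cancel (forget u) (i , true) (forget v))

  representativeP : ComixTrivial RP RQ → ∀ u →
    ∃[ w ] (AQ.Trivial w × ∀ x → AP.ev u x ≡ AP.ev w x)
  representativeP comixTrivial u =
    Coset.congruent actP actQ
      (subst₂ (WordEq _ _) (forget-embed₁ u) refl (forget-respects (comixTrivial (embed₁ u))))

  representativeQ : ComixTrivial RP RQ → ∀ v →
    ∃[ w ] (AP.Trivial w × ∀ x → AQ.ev v x ≡ AQ.ev w x)
  representativeQ comixTrivial v =
    Coset.congruent actQ actP
      (WordEq-swap (subst₂ (WordEq _ _) (forget-embed₂ v) refl
        (forget-respects (comixTrivial (embed₂ v)))))

corollary3p4 : (n : ℕ) (P Q : Polytope n) → Finite P → Finite Q →
    (RP : Rotations P) (RQ : Rotations Q) →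
    ChiralOrDirectlyRegular RP → ChiralOrDirectlyRegular RQ →
    ComixTrivial RP RQ → MixIsProduct RP RQ
corollary3p4 n P Q _ _ RP RQ _ _ comixTrivial u v
  with representativeP RP RQ comixTrivial u | representativeQ RP RQ comixTrivial v
... | u' , u'-trivialInQ , u≈u' | v' , v'-trivialInP , v≈v' =
  u' ++ v' , valueInP , valueInQ
  where
  module AP = Action (rotationAction RP)
  module AQ = Action (rotationAction RQ)

  valueInP : ∀ x → AP.ev (u' ++ v') x ≡ AP.ev u x
  valueInP x = trans (AP.ev-++ u' v' x)
                 (trans (cong (AP.ev u') (v'-trivialInP x)) (sym (u≈u' x)))

  valueInQ : ∀ x → AQ.ev (u' ++ v') x ≡ AQ.ev v x
  valueInQ x = trans (AQ.ev-++ u' v' x) (trans (u'-trivialInQ _) (sym (v≈v' x)))
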